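{- Let $\mathscr D$ and $\mathscr Q$ be disjoint schemas and let $\Sigma,\Sigma'$ be finite sets of TGDs. Then $[\![\Sigma]\!]^{\mathsf{UCQ}}_{\mathscr D,\mathscr Q}=[\![\Sigma']\!]^{\mathsf{UCQ}}_{\mathscr D,\mathscr Q}$ if and only if $[\![\Sigma]\!]^{\mathsf{CQ}}_{\mathscr D,\mathscr Q}=[\![\Sigma']\!]^{\mathsf{CQ}}_{\mathscr D,\mathscr Q}$.
   Context: Terms are constants, labeled nulls, or variables; a database is a finite set of relational atoms containing no variables or nulls. A Boolean UCQ is a sentence built from relational atoms (constants allowed) using only $\wedge,\vee,\exists$; $\mathsf{UCQ}$ is their class, and $\mathsf{CQ}$ the class of Boolean CQs $\exists\mathbf y\,\varphi$ with $\varphi$ a nonempty conjunction of relational atoms. A TGD is a sentence $\forall\mathbf x\forall\mathbf y(\phi(\mathbf x,\mathbf y)\rightarrow\exists\mathbf z\,\psi(\mathbf x,\mathbf z))$ with $\phi,\psi$ conjunctions of relational atoms, each variable of $\mathbf x$ in $\phi$. $D\cup\Sigma\vDash q$ means every instance containing $D$ and satisfying $\Sigma$ satisfies $q$. For a class $\mathcal Q$ of Boolean UCQs, $[\![\Sigma]\!]^{\mathcal Q}_{\mathscr D,\mathscr Q}$ is the set of pairs $(D,q)$ with $D$ a $\mathscr D$-database, $q\in\mathcal Q$ using only relation symbols of $\mathscr Q$, and $D\cup\Sigma\vDash q$. -}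

module Defs where

open import Data.Nat using (ℕ; _≡ᵇ_)
open import Data.Bool using (if_then_else_)
open import Data.Vec using (Vec; map)
open import Data.Vec.Membership.Propositional renaming (_∈_ to _∈ᵥ_)
open import Data.List using (List)
open import Data.List.Membership.Propositional using (_∈_)
open import Data.List.Relation.Unary.All using (All)
open import Data.List.Relation.Unary.Any using (Any)
open import Data.Product using (Σ; _×_; ∃)
open import Data.Sum using (_⊎_)
open import Data.Empty using (⊥)
open import Relation.Binary.PropositionalEquality using (_≡_; _≢_)
open import Relation.Nullary using (¬_)
open import Function.Bundles using (_⇔_)

record RelSym : Set where
  constructor rs
  field
    name  : ℕ
    arity : ℕ
open RelSym public

Schema : Set
Schema = List RelSym

Disjoint : Schema → Schema → Set
Disjoint S T = ∀ R → R ∈ S → R ∈ T → ⊥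

record Atom (T : Set) : Set where
  constructor _⟨_⟩
  field
    rel  : RelSym
    args : Vec T (arity rel)
open Atom public

Const : Set
Const = ℕ

Var : Set
Var = ℕ

data Term : Set where
  cst : Const → Term
  var : Var → Term

-- terms occurring in instances: constants or labeled nulls
data GTerm : Set where
  gcst  : Const → GTerm
  gnull : ℕ → GTerm

-- Instances (possibly infinite sets of atoms over constants and nulls),
-- databases (finite sets of atoms over constants only)

Instance : Set₁
Instance = (R : RelSym) → Vec GTerm (arity R) → Set

Database : Set
Database = List (Atom Const)

IsDatabaseOver : Schema → Database → Set
IsDatabaseOver S D = All (λ a → rel a ∈ S) D

Contains : Instance → Database → Set
Contains I D = All (λ a → I (rel a) (map gcst (args a))) D

Assignment : Set
Assignment = Var → GTerm

evalT : Assignment → Term → GTerm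
evalT ν (cst c) = gcst c
evalT ν (var x) = ν x

upd : Assignment → Var → GTerm → Assignment
upd ν x t y = if x ≡ᵇ y then t else ν y

HoldsAtom : Instance → Assignment → Atom Term → Set
HoldsAtom I ν a = I (rel a) (map (evalT ν) (args a))

-- A TGD  ∀x∀y (φ(x,y) → ∃z ψ(x,z))  is given by its body φ and
-- head ψ (conjunctions = lists of atoms); the universally quantified
-- variables are those of the body, the existential ones those of the
-- head not occurring in the body.

record TGD : Set where
  constructor _⇒_
  field
    body : List (Atom Term)
    head : List (Atom Term)
open TGD public

OccursIn : Var → List (Atom Term) → Set
OccursIn x as = Any (λ a → var x ∈ᵥ args a) as

SatTGD : Instance → TGD → Set
SatTGD I τ =
  ∀ (ν : Assignment) → All (HoldsAtom I ν) (body τ) →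
    ∃ λ (ν' : Assignment) →
      (∀ x → OccursIn x (body τ) → ν' x ≡ ν x) × All (HoldsAtom I ν') (head τ)

SatTGDs : Instance → List TGD → Set
SatTGDs I Σ' = All (SatTGD I) Σ'

data PFormula : Set where
  atom : Atom Term → PFormula
  _∧'_ : PFormula → PFormula → PFormula
  _∨'_ : PFormula → PFormula → PFormula
  ex   : Var → PFormula → PFormula

⟦_⟧ : PFormula → Instance → Assignment → Set
⟦ atom a ⟧   I ν = HoldsAtom I ν a
⟦ φ ∧' ψ ⟧   I ν = ⟦ φ ⟧ I ν × ⟦ ψ ⟧ I ν
⟦ φ ∨' ψ ⟧   I ν = ⟦ φ ⟧ I ν ⊎ ⟦ ψ ⟧ I ν
⟦ ex x φ ⟧   I ν = Σ GTerm λ t → ⟦ φ ⟧ I (upd ν x t)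

FreeIn : Var → PFormula → Set
FreeIn x (atom a)  = var x ∈ᵥ args a
FreeIn x (φ ∧' ψ)  = FreeIn x φ ⊎ FreeIn x ψ
FreeIn x (φ ∨' ψ)  = FreeIn x φ ⊎ FreeIn x ψ
FreeIn x (ex y φ)  = (y ≢ x) × FreeIn x φ

Closed : PFormula → Set
Closed φ = ∀ x → ¬ FreeIn x φ

UsesOnly : Schema → PFormula → Set
UsesOnly S (atom a) = rel a ∈ S
UsesOnly S (φ ∧' ψ) = UsesOnly S φ × UsesOnly S ψ
UsesOnly S (φ ∨' ψ) = UsesOnly S φ × UsesOnly S ψ
UsesOnly S (ex y φ) = UsesOnly S φ

data IsConj : PFormula → Set where
  c-atom : ∀ a → IsConj (atom a)
  c-and  : ∀ {φ ψ} → IsConj φ → IsConj ψ → IsConj (φ ∧' ψ)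

data IsCQShape : PFormula → Set where
  cq-body : ∀ {φ} → IsConj φ → IsCQShape φ
  cq-ex   : ∀ {φ} y → IsCQShape φ → IsCQShape (ex y φ)

QClass : Set₁
QClass = PFormula → Set

UCQ : QClass
UCQ φ = Closed φ

CQ : QClass
CQ φ = Closed φ × IsCQShape φ

Entails : Database → List TGD → PFormula → Set₁
Entails D Σ' q =
  ∀ (I : Instance) → Contains I D → SatTGDs I Σ' → ∀ (ν : Assignment) → ⟦ q ⟧ I ν

-- [[Σ]]^𝒬_{𝒟,𝒬} as a predicate on pairs (D , q)
Sem : QClass → List TGD → Schema → Schema → Database → PFormula → Set₁
Sem C Σ' 𝒟 𝒬 D q = IsDatabaseOver 𝒟 D × C q × UsesOnly 𝒬 q × Entails D Σ' q

SemEq : QClass → List TGD → List TGD → Schema → Schema → Set₁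
SemEq C Σ₁ Σ₂ 𝒟 𝒬 = ∀ D q → Sem C Σ₁ 𝒟 𝒬 D q ⇔ Sem C Σ₂ 𝒟 𝒬 D q

-- Every CQ is a UCQ, so UCQ-equivalence implies CQ-equivalence. Conversely let D ∪ Σ₁ ⊨ q with q a
-- UCQ. The chase of D under Σ₁ is a model of D and Σ₁ that maps into every model of D and Σ₁ by a
-- homomorphism fixing the constants. So q holds in the chase, and since q is positive, finitely
-- many chase facts already witness it. Reading the nulls of these facts as variables gives a CQ q′
-- over the schema of q with D ∪ Σ₁ ⊨ q′ (by universality) and q′ ⊨ q; CQ-equivalence yields
-- D ∪ Σ₂ ⊨ q′ and hence D ∪ Σ₂ ⊨ q.
-- Constructively, each null of the chase is named, through a coding of trees into ℕ, by the
-- trigger that invented it, and the homomorphism into a model is computed by replaying this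
-- provenance inside the model.

module Submission where

open import Defs
open import Data.List using (List)
open import Function.Bundles using (_⇔_)
open import Data.Nat using (ℕ; zero; suc; _+_; _≡ᵇ_; _≟_)
open import Data.Nat.Properties using (+-suc; +-identityʳ; ≡ᵇ⇒≡; ≡⇒≡ᵇ)
open import Data.Nat.Binary using (ℕᵇ; 2[1+_]; 1+[2_]; toℕ; fromℕ)
open import Data.Nat.Binary.Properties using (fromℕ-toℕ)
open import Data.Bool using (true; false; T; if_then_else_)
open import Data.Vec using (Vec; []; _∷_; map)
import Data.Vec.Properties as Vec
import Data.Product.Properties as ×
open import Data.Vec.Relation.Unary.Any using (here; there)
open import Data.Vec.Membership.Propositional using () renaming (_∈_ to _∈ᵥ_)
open import Data.Vec.Membership.Propositional.Properties using (∈-map⁺)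
open import Data.List as List using ([]; _∷_; _++_; _ʳ++_; length)
open import Data.List.Properties using (++-assoc; ++-identityʳ; map-∘)
open import Data.List.Membership.Propositional using (_∈_; _∉_)
open import Data.List.Membership.DecPropositional _≟_ using (_∈?_)
open import Data.List.Relation.Binary.Pointwise using (Pointwise; []; _∷_)
open import Data.List.Relation.Unary.All as All using (All; []; _∷_)
open import Data.List.Relation.Unary.All.Properties using (++⁺; ++⁻; map⁺)
open import Data.List.Relation.Unary.Any using (here; there)
open import Data.List.Membership.Propositional.Properties using (∈-++⁺ˡ; ∈-++⁺ʳ; ∈-++⁻)
open import Data.Maybe as Maybe using (Maybe; just; nothing; _>>=_; maybe′)
open import Data.Product using (Σ; _×_; _,_; proj₁; proj₂)
open import Data.Sum using (_⊎_; inj₁; inj₂)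
open import Data.Empty using (⊥; ⊥-elim)
open import Relation.Binary.PropositionalEquality
open import Function using (_∘_)
open import Function.Bundles using (mk⇔; Equivalence)
open import Function.Properties.Equivalence using () renaming (sym to ⇔-sym)
open import Relation.Nullary using (Dec; yes; no; map′; _×-dec_)
open import Relation.Binary.Definitions using (DecidableEquality)

-- Coding trees into ℕ

data Rose : Set where
  node : ℕ → List Rose → Rose

leaf : ℕ → Rose
leaf n = node n []

-- Postfix order (children, then label and number of children), so that a stack machine decodes it.
serialise : Rose → List ℕ
serialiseForest : List Rose → List ℕ
serialise (node n ts) = serialiseForest ts ++ n ∷ length ts ∷ []
serialiseForest [] = []
serialiseForest (t ∷ ts) = serialise t ++ serialiseForest ts

pop : ℕ → List Rose → List Rose → List Rose × List Rose
pop zero    st       acc = acc , st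
pop (suc k) []       acc = acc , []
pop (suc k) (t ∷ st) acc = pop k st (t ∷ acc)

rebuild : List ℕ → List Rose → List Rose
rebuild []           st = st
rebuild (n ∷ [])     st = st
rebuild (n ∷ k ∷ ns) st = let (ts , st′) = pop k st [] in rebuild ns (node n ts ∷ st′)

pop-ʳ++ : ∀ ts m st acc → pop (length ts + m) (ts ʳ++ st) acc ≡ pop m st (ts ++ acc)
pop-ʳ++ []       m st acc = refl
pop-ʳ++ (t ∷ ts) m st acc = begin
  pop (suc (length ts) + m) (ts ʳ++ t ∷ st) acc
    ≡⟨ cong (λ k → pop k (ts ʳ++ t ∷ st) acc) (sym (+-suc (length ts) m)) ⟩
  pop (length ts + suc m) (ts ʳ++ t ∷ st) acc
    ≡⟨ pop-ʳ++ ts (suc m) (t ∷ st) acc ⟩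
  pop (suc m) (t ∷ st) (ts ++ acc) ∎
  where open ≡-Reasoning

pop-reverse : ∀ ts st → pop (length ts) (ts ʳ++ st) [] ≡ (ts , st)
pop-reverse ts st = begin
  pop (length ts) (ts ʳ++ st) []
    ≡⟨ cong (λ k → pop k (ts ʳ++ st) []) (sym (+-identityʳ (length ts))) ⟩
  pop (length ts + 0) (ts ʳ++ st) []
    ≡⟨ pop-ʳ++ ts 0 st [] ⟩
  (ts ++ [] , st)
    ≡⟨ cong (_, st) (++-identityʳ ts) ⟩
  (ts , st) ∎
  where open ≡-Reasoning

rebuild-serialise : ∀ t ns st → rebuild (serialise t ++ ns) st ≡ rebuild ns (t ∷ st)
rebuild-serialiseForest : ∀ ts ns st → rebuild (serialiseForest ts ++ ns) st ≡ rebuild ns (ts ʳ++ st)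
rebuild-serialise (node n ts) ns st
  rewrite ++-assoc (serialiseForest ts) (n ∷ length ts ∷ []) ns
        | rebuild-serialiseForest ts (n ∷ length ts ∷ ns) st
        | pop-reverse ts st = refl
rebuild-serialiseForest []       ns st = refl
rebuild-serialiseForest (t ∷ ts) ns st
  rewrite ++-assoc (serialise t) (serialiseForest ts) ns
        | rebuild-serialise t (serialiseForest ts ++ ns) st = rebuild-serialiseForest ts ns (t ∷ st)

-- In binary, 2[1+_] ends an entry and 1+[2_] increments it.
natsToℕᵇ : List ℕ → ℕᵇ
natsToℕᵇ′ : ℕ → List ℕ → ℕᵇ
natsToℕᵇ []       = ℕᵇ.zero
natsToℕᵇ (n ∷ ns) = natsToℕᵇ′ n ns
natsToℕᵇ′ zero    ns = 2[1+ natsToℕᵇ ns ]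
natsToℕᵇ′ (suc n) ns = 1+[2 natsToℕᵇ′ n ns ]

ℕᵇToNats : ℕᵇ → List ℕ
ℕᵇToNats ℕᵇ.zero  = []
ℕᵇToNats 2[1+ b ] = 0 ∷ ℕᵇToNats b
ℕᵇToNats 1+[2 b ] with ℕᵇToNats b
... | []     = []
... | n ∷ ns = suc n ∷ ns

ℕᵇToNats-natsToℕᵇ : ∀ ns → ℕᵇToNats (natsToℕᵇ ns) ≡ ns
ℕᵇToNats-natsToℕᵇ′ : ∀ n ns → ℕᵇToNats (natsToℕᵇ′ n ns) ≡ n ∷ ns
ℕᵇToNats-natsToℕᵇ []       = refl
ℕᵇToNats-natsToℕᵇ (n ∷ ns) = ℕᵇToNats-natsToℕᵇ′ n ns
ℕᵇToNats-natsToℕᵇ′ zero    ns = cong (0 ∷_) (ℕᵇToNats-natsToℕᵇ ns)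
ℕᵇToNats-natsToℕᵇ′ (suc n) ns rewrite ℕᵇToNats-natsToℕᵇ′ n ns = refl

encodeRose : Rose → ℕ
encodeRose t = toℕ (natsToℕᵇ (serialise t))

decodeRose : ℕ → Maybe Rose
decodeRose n = List.head (rebuild (ℕᵇToNats (fromℕ n)) [])

decodeRose-encodeRose : ∀ t → decodeRose (encodeRose t) ≡ just t
decodeRose-encodeRose t
  rewrite fromℕ-toℕ (natsToℕᵇ (serialise t))
        | ℕᵇToNats-natsToℕᵇ (serialise t)
        | sym (++-identityʳ (serialise t))
        | rebuild-serialise t [] [] = refl

≡ᵇ≡true⇒≡ : ∀ {m n} → (m ≡ᵇ n) ≡ true → m ≡ n
≡ᵇ≡true⇒≡ {m} {n} eq = ≡ᵇ⇒≡ m n (subst T (sym eq) _)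

≡ᵇ≡false⇒≢ : ∀ {m n} → (m ≡ᵇ n) ≡ false → m ≢ n
≡ᵇ≡false⇒≢ {m} {n} eq m≡n = subst T eq (≡⇒≡ᵇ m n m≡n)

substNulls : (ℕ → GTerm) → GTerm → GTerm
substNulls f (gcst c)  = gcst c
substNulls f (gnull n) = f n

map-evalT-cong : ∀ {n} (v : Vec Term n) {ν μ : Assignment} →
  (∀ z → var z ∈ᵥ v → ν z ≡ μ z) → map (evalT ν) v ≡ map (evalT μ) v
map-evalT-cong []          h = refl
map-evalT-cong (cst c ∷ v) h = cong (gcst c ∷_) (map-evalT-cong v (λ z p → h z (there p)))
map-evalT-cong (var x ∷ v) h = cong₂ _∷_ (h x (here refl)) (map-evalT-cong v (λ z p → h z (there p)))

map-substNulls-evalT : ∀ {n} (v : Vec Term n) (f : ℕ → GTerm) (ν : Assignment) →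
  map (substNulls f) (map (evalT ν) v) ≡ map (evalT (substNulls f ∘ ν)) v
map-substNulls-evalT []          f ν = refl
map-substNulls-evalT (cst c ∷ v) f ν = cong (gcst c ∷_) (map-substNulls-evalT v f ν)
map-substNulls-evalT (var x ∷ v) f ν = cong (substNulls f (ν x) ∷_) (map-substNulls-evalT v f ν)

map-substNulls-gcst : ∀ (f : ℕ → GTerm) {n} (w : Vec Const n) → map (substNulls f) (map gcst w) ≡ map gcst w
map-substNulls-gcst f []      = refl
map-substNulls-gcst f (c ∷ w) = cong (gcst c ∷_) (map-substNulls-gcst f w)

substNulls-upd : ∀ (f : ℕ → GTerm) ν x t z →
  substNulls f (upd ν x t z) ≡ upd (substNulls f ∘ ν) x (substNulls f t) z
substNulls-upd f ν x t z with x ≡ᵇ z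
... | true  = refl
... | false = refl

⟦⟧-cong : ∀ φ {I} {ν μ : Assignment} → (∀ z → FreeIn z φ → ν z ≡ μ z) → ⟦ φ ⟧ I ν → ⟦ φ ⟧ I μ
⟦⟧-cong (atom a) {I} h p = subst (I (rel a)) (map-evalT-cong (args a) h) p
⟦⟧-cong (φ ∧' ψ) h (p , q) = ⟦⟧-cong φ (λ z f → h z (inj₁ f)) p , ⟦⟧-cong ψ (λ z f → h z (inj₂ f)) q
⟦⟧-cong (φ ∨' ψ) h (inj₁ p) = inj₁ (⟦⟧-cong φ (λ z f → h z (inj₁ f)) p)
⟦⟧-cong (φ ∨' ψ) h (inj₂ q) = inj₂ (⟦⟧-cong ψ (λ z f → h z (inj₂ f)) q)
⟦⟧-cong (ex x φ) {ν = ν} {μ} h (t , p) = t , ⟦⟧-cong φ agree p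
  where
  agree : ∀ z → FreeIn z φ → upd ν x t z ≡ upd μ x t z
  agree z fz with x ≡ᵇ z in eq
  ... | true  = refl
  ... | false = h z (≡ᵇ≡false⇒≢ eq , fz)

⟦⟧-closed : ∀ φ {I} → Closed φ → ∀ ν μ → ⟦ φ ⟧ I ν → ⟦ φ ⟧ I μ
⟦⟧-closed φ closed ν μ = ⟦⟧-cong φ (λ z f → ⊥-elim (closed z f))

-- Witnesses and canonical conjunctive queries

Holds : Instance → List (Atom GTerm) → Set
Holds I = All (λ b → I (rel b) (args b))

MapsInto : (ℕ → GTerm) → List (Atom GTerm) → Instance → Set
MapsInto f bs I = All (λ b → I (rel b) (map (substNulls f) (args b))) bs

InSchema : Schema → List (Atom GTerm) → Set
InSchema S = All (λ b → rel b ∈ S)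

record Witness (S : Schema) (U : Instance) (φ : PFormula) (ν : Assignment) : Set₁ where
  constructor witness
  field
    first      : Atom GTerm
    rest       : List (Atom GTerm)
    holds      : Holds U (first ∷ rest)
    inSchema   : InSchema S (first ∷ rest)
    sufficient : ∀ J f → MapsInto f (first ∷ rest) J → ⟦ φ ⟧ J (substNulls f ∘ ν)

witness-of-⟦⟧ : ∀ S U φ ν → UsesOnly S φ → ⟦ φ ⟧ U ν → Witness S U φ ν
witness-of-⟦⟧ S U (atom a) ν a∈S p =
  witness (rel a ⟨ map (evalT ν) (args a) ⟩) [] (p ∷ []) (a∈S ∷ [])
    λ { J f (q ∷ []) → subst (J (rel a)) (map-substNulls-evalT (args a) f ν) q }
witness-of-⟦⟧ S U (φ ∧' ψ) ν (φ⊆S , ψ⊆S) (p , q)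
  with witness-of-⟦⟧ S U φ ν φ⊆S p | witness-of-⟦⟧ S U ψ ν ψ⊆S q
... | witness a₁ L₁ h₁ s₁ k₁ | witness a₂ L₂ h₂ s₂ k₂ =
  witness a₁ (L₁ ++ a₂ ∷ L₂) (++⁺ h₁ h₂) (++⁺ s₁ s₂)
    λ J f m → let (m₁ , m₂) = ++⁻ (a₁ ∷ L₁) m in k₁ J f m₁ , k₂ J f m₂
witness-of-⟦⟧ S U (φ ∨' ψ) ν (φ⊆S , _) (inj₁ p) with witness-of-⟦⟧ S U φ ν φ⊆S p
... | witness a L h s k = witness a L h s λ J f m → inj₁ (k J f m)
witness-of-⟦⟧ S U (φ ∨' ψ) ν (_ , ψ⊆S) (inj₂ q) with witness-of-⟦⟧ S U ψ ν ψ⊆S q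
... | witness a L h s k = witness a L h s λ J f m → inj₂ (k J f m)
witness-of-⟦⟧ S U (ex x φ) ν φ⊆S (t , p) with witness-of-⟦⟧ S U φ (upd ν x t) φ⊆S p
... | witness a L h s k = witness a L h s λ J f m →
  substNulls f t , ⟦⟧-cong φ (λ z _ → substNulls-upd f ν x t z) (k J f m)

nullToVar : GTerm → Term
nullToVar (gcst c)  = cst c
nullToVar (gnull n) = var n

nullsIn : ∀ {n} → Vec GTerm n → List Var
nullsIn []            = []
nullsIn (gcst c ∷ v)  = nullsIn v
nullsIn (gnull m ∷ v) = m ∷ nullsIn v

nullsInAtoms : List (Atom GTerm) → List Var
nullsInAtoms []       = []
nullsInAtoms (b ∷ bs) = nullsIn (args b) ++ nullsInAtoms bs

conjunction : Atom GTerm → List (Atom GTerm) → PFormula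
conjunction b []        = atom (rel b ⟨ map nullToVar (args b) ⟩)
conjunction b (b′ ∷ bs) = atom (rel b ⟨ map nullToVar (args b) ⟩) ∧' conjunction b′ bs

∃* : List Var → PFormula → PFormula
∃* []       φ = φ
∃* (y ∷ ys) φ = ex y (∃* ys φ)

canonicalCQ : Atom GTerm → List (Atom GTerm) → PFormula
canonicalCQ b bs = ∃* (nullsInAtoms (b ∷ bs)) (conjunction b bs)

map-evalT-nullToVar : ∀ {n} (v : Vec GTerm n) (μ : Assignment) →
  map (evalT μ) (map nullToVar v) ≡ map (substNulls μ) v
map-evalT-nullToVar []            μ = refl
map-evalT-nullToVar (gcst c ∷ v)  μ = cong (gcst c ∷_) (map-evalT-nullToVar v μ)
map-evalT-nullToVar (gnull m ∷ v) μ = cong (μ m ∷_) (map-evalT-nullToVar v μ)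

var∈nullToVar⇒∈nullsIn : ∀ {n} (v : Vec GTerm n) x → var x ∈ᵥ map nullToVar v → x ∈ nullsIn v
var∈nullToVar⇒∈nullsIn (gcst c ∷ v)  x (there p)   = var∈nullToVar⇒∈nullsIn v x p
var∈nullToVar⇒∈nullsIn (gnull m ∷ v) x (here refl) = here refl
var∈nullToVar⇒∈nullsIn (gnull m ∷ v) x (there p)   = there (var∈nullToVar⇒∈nullsIn v x p)

free-conjunction : ∀ b bs x → FreeIn x (conjunction b bs) → x ∈ nullsInAtoms (b ∷ bs)
free-conjunction b []        x f        = ∈-++⁺ˡ (var∈nullToVar⇒∈nullsIn (args b) x f)
free-conjunction b (b′ ∷ bs) x (inj₁ f) = ∈-++⁺ˡ (var∈nullToVar⇒∈nullsIn (args b) x f)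
free-conjunction b (b′ ∷ bs) x (inj₂ f) = ∈-++⁺ʳ (nullsIn (args b)) (free-conjunction b′ bs x f)

free-∃*⇒∉ : ∀ ys φ x → FreeIn x (∃* ys φ) → x ∈ ys → ⊥
free-∃*⇒∉ (y ∷ ys) φ x (y≢x , f) (here refl) = y≢x refl
free-∃*⇒∉ (y ∷ ys) φ x (_ , f)   (there x∈ys) = free-∃*⇒∉ ys φ x f x∈ys

free-∃*⇒free : ∀ ys φ x → FreeIn x (∃* ys φ) → FreeIn x φ
free-∃*⇒free []       φ x f       = f
free-∃*⇒free (y ∷ ys) φ x (_ , f) = free-∃*⇒free ys φ x f

canonicalCQ-CQ : ∀ b bs → CQ (canonicalCQ b bs)
canonicalCQ-CQ b bs = closed , ∃*-shape (nullsInAtoms (b ∷ bs)) (cq-body (conjunction-isConj b bs))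
  where
  closed : Closed (canonicalCQ b bs)
  closed x f = free-∃*⇒∉ (nullsInAtoms (b ∷ bs)) _ x f
    (free-conjunction b bs x (free-∃*⇒free (nullsInAtoms (b ∷ bs)) _ x f))
  conjunction-isConj : ∀ b bs → IsConj (conjunction b bs)
  conjunction-isConj b []        = c-atom _
  conjunction-isConj b (b′ ∷ bs) = c-and (c-atom _) (conjunction-isConj b′ bs)
  ∃*-shape : ∀ ys {φ} → IsCQShape φ → IsCQShape (∃* ys φ)
  ∃*-shape []       s = s
  ∃*-shape (y ∷ ys) s = cq-ex y (∃*-shape ys s)

canonicalCQ-usesOnly : ∀ S b bs → InSchema S (b ∷ bs) → UsesOnly S (canonicalCQ b bs)
canonicalCQ-usesOnly S b bs s = ∃*-usesOnly (nullsInAtoms (b ∷ bs)) (conjunction-usesOnly b bs s)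
  where
  conjunction-usesOnly : ∀ b bs → InSchema S (b ∷ bs) → UsesOnly S (conjunction b bs)
  conjunction-usesOnly b []        (s ∷ [])     = s
  conjunction-usesOnly b (b′ ∷ bs) (s ∷ ss)     = s , conjunction-usesOnly b′ bs ss
  ∃*-usesOnly : ∀ ys {φ} → UsesOnly S φ → UsesOnly S (∃* ys φ)
  ∃*-usesOnly []       u = u
  ∃*-usesOnly (y ∷ ys) u = ∃*-usesOnly ys u

∃*-intro : ∀ {I} ys φ ν μ → (∀ z → FreeIn z φ → z ∈ ys ⊎ ν z ≡ μ z) → ⟦ φ ⟧ I μ → ⟦ ∃* ys φ ⟧ I ν
∃*-intro []       φ ν μ h p = ⟦⟧-cong φ agree p
  where
  agree : ∀ z → FreeIn z φ → μ z ≡ ν z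
  agree z f with h z f
  ... | inj₂ e = sym e
∃*-intro (y ∷ ys) φ ν μ h p = μ y , ∃*-intro ys φ (upd ν y (μ y)) μ h′ p
  where
  h′ : ∀ z → FreeIn z φ → z ∈ ys ⊎ upd ν y (μ y) z ≡ μ z
  h′ z f with y ≡ᵇ z in eq | h z f
  ... | true  | _                  = inj₂ (cong μ (≡ᵇ≡true⇒≡ eq))
  ... | false | inj₁ (here refl)   = ⊥-elim (≡ᵇ≡false⇒≢ {z} eq refl)
  ... | false | inj₁ (there z∈ys)  = inj₁ z∈ys
  ... | false | inj₂ e             = inj₂ e

∃*-elim : ∀ {I} ys φ ν → ⟦ ∃* ys φ ⟧ I ν → Σ Assignment (⟦ φ ⟧ I)
∃*-elim []       φ ν p       = ν , p
∃*-elim (y ∷ ys) φ ν (t , p) = ∃*-elim ys φ (upd ν y t) p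

canonicalCQ-intro : ∀ {I} μ b bs ν → MapsInto μ (b ∷ bs) I → ⟦ canonicalCQ b bs ⟧ I ν
canonicalCQ-intro {I} μ b bs ν m =
  ∃*-intro (nullsInAtoms (b ∷ bs)) (conjunction b bs) ν μ
    (λ z f → inj₁ (free-conjunction b bs z f)) (conjunction-intro b bs m)
  where
  conjunction-intro : ∀ b bs → MapsInto μ (b ∷ bs) I → ⟦ conjunction b bs ⟧ I μ
  conjunction-intro b []        (p ∷ [])  = subst (I (rel b)) (sym (map-evalT-nullToVar (args b) μ)) p
  conjunction-intro b (b′ ∷ bs) (p ∷ ps)  =
    subst (I (rel b)) (sym (map-evalT-nullToVar (args b) μ)) p , conjunction-intro b′ bs ps

canonicalCQ-elim : ∀ {I} b bs ν → ⟦ canonicalCQ b bs ⟧ I ν → Σ Assignment λ μ → MapsInto μ (b ∷ bs) I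
canonicalCQ-elim {I} b bs ν p =
  let (μ , q) = ∃*-elim (nullsInAtoms (b ∷ bs)) (conjunction b bs) ν p in μ , conjunction-elim μ b bs q
  where
  conjunction-elim : ∀ μ b bs → ⟦ conjunction b bs ⟧ I μ → MapsInto μ (b ∷ bs) I
  conjunction-elim μ b []        p        = subst (I (rel b)) (map-evalT-nullToVar (args b) μ) p ∷ []
  conjunction-elim μ b (b′ ∷ bs) (p , ps) =
    subst (I (rel b)) (map-evalT-nullToVar (args b) μ) p ∷ conjunction-elim μ b′ bs ps

-- The chase

_!_ : {A : Set} → List A → ℕ → Maybe A
[]       ! k     = nothing
(x ∷ xs) ! zero  = just x
(x ∷ xs) ! suc k = xs ! k

!-complete : {A : Set} (xs : List A) → All (λ x → Σ ℕ λ k → xs ! k ≡ just x) xs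
!-complete []       = []
!-complete (x ∷ xs) = (zero , refl) ∷ All.map (λ (k , e) → suc k , e) (!-complete xs)

lookupAll : {A : Set} {P : A → Set} {xs : List A} → All P xs → ℕ → Maybe (Σ A P)
lookupAll []               k       = nothing
lookupAll (_∷_ {x} p ps)   zero    = just (x , p)
lookupAll (p ∷ ps)         (suc k) = lookupAll ps k

lookupAll-! : {A : Set} {P : A → Set} {xs : List A} (ps : All P xs) (k : ℕ) {x : A} →
  xs ! k ≡ just x → Σ (P x) λ p → lookupAll ps k ≡ just (x , p)
lookupAll-! (p ∷ ps) zero    refl = p , refl
lookupAll-! (p ∷ ps) (suc k) e    = lookupAll-! ps k e

-- Off the listed variables the assignment is junk.
_↦_ : List Var → List GTerm → Assignment
((y ∷ ys) ↦ (w ∷ ws)) x = if y ≡ᵇ x then w else (ys ↦ ws) x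
(_ ↦ _) x = gcst 0

↦-map-self : ∀ (f : Var → GTerm) ys {x} → x ∈ ys → (ys ↦ List.map f ys) x ≡ f x
↦-map-self f (y ∷ ys) {x} x∈ys with y ≡ᵇ x in eq | x∈ys
... | true  | _            = cong f (≡ᵇ≡true⇒≡ eq)
... | false | here refl    = ⊥-elim (≡ᵇ≡false⇒≢ {x} eq refl)
... | false | there x∈ys′  = ↦-map-self f ys x∈ys′

↦-map : ∀ (h : GTerm → GTerm) → h (gcst 0) ≡ gcst 0 → ∀ ys ws x →
  (ys ↦ List.map h ws) x ≡ h ((ys ↦ ws) x)
↦-map h h0 []       ws       x = sym h0
↦-map h h0 (y ∷ ys) []       x = sym h0
↦-map h h0 (y ∷ ys) (w ∷ ws) x with y ≡ᵇ x
... | true  = refl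
... | false = ↦-map h h0 ys ws x

↦-All : ∀ (P : GTerm → Set) → P (gcst 0) → ∀ ys {ws} → All P ws → ∀ x → P ((ys ↦ ws) x)
↦-All P p0 []       ps       x = p0
↦-All P p0 (y ∷ ys) []       x = p0
↦-All P p0 (y ∷ ys) (p ∷ ps) x with y ≡ᵇ x
... | true  = p
... | false = ↦-All P p0 ys ps x

varsOf : ∀ {n} → Vec Term n → List Var
varsOf []          = []
varsOf (cst c ∷ v) = varsOf v
varsOf (var x ∷ v) = x ∷ varsOf v

varsOfAtoms : List (Atom Term) → List Var
varsOfAtoms []       = []
varsOfAtoms (a ∷ as) = varsOf (args a) ++ varsOfAtoms as

bodyVars : TGD → List Var
bodyVars τ = varsOfAtoms (body τ)

var∈⇒∈varsOf : ∀ {n} (v : Vec Term n) {x} → var x ∈ᵥ v → x ∈ varsOf v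
var∈⇒∈varsOf (cst c ∷ v) (there p)   = var∈⇒∈varsOf v p
var∈⇒∈varsOf (var y ∷ v) (here refl) = here refl
var∈⇒∈varsOf (var y ∷ v) (there p)   = there (var∈⇒∈varsOf v p)

∈varsOf⇒var∈ : ∀ {n} (v : Vec Term n) {x} → x ∈ varsOf v → var x ∈ᵥ v
∈varsOf⇒var∈ (cst c ∷ v) p           = there (∈varsOf⇒var∈ v p)
∈varsOf⇒var∈ (var y ∷ v) (here refl) = here refl
∈varsOf⇒var∈ (var y ∷ v) (there p)   = there (∈varsOf⇒var∈ v p)

occurs⇒∈varsOfAtoms : ∀ as {x} → OccursIn x as → x ∈ varsOfAtoms as
occurs⇒∈varsOfAtoms (a ∷ as) (here p)  = ∈-++⁺ˡ (var∈⇒∈varsOf (args a) p)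
occurs⇒∈varsOfAtoms (a ∷ as) (there p) = ∈-++⁺ʳ (varsOf (args a)) (occurs⇒∈varsOfAtoms as p)

∈varsOfAtoms⇒occurs : ∀ as {x} → x ∈ varsOfAtoms as → OccursIn x as
∈varsOfAtoms⇒occurs (a ∷ as) p with ∈-++⁻ (varsOf (args a)) p
... | inj₁ q = here (∈varsOf⇒var∈ (args a) q)
... | inj₂ q = there (∈varsOfAtoms⇒occurs as q)

_≟ʳ_ : DecidableEquality RelSym
rs n a ≟ʳ rs m b =
  map′ (λ (n≡m , a≡b) → cong₂ rs n≡m a≡b) (λ { refl → refl , refl }) (n ≟ m ×-dec a ≟ b)

_≟ᵍ_ : DecidableEquality GTerm
gcst a  ≟ᵍ gcst b  = map′ (cong gcst) (λ { refl → refl }) (a ≟ b)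
gnull a ≟ᵍ gnull b = map′ (cong gnull) (λ { refl → refl }) (a ≟ b)
gcst a  ≟ᵍ gnull b = no λ ()
gnull a ≟ᵍ gcst b  = no λ ()

GFact : Set
GFact = Σ RelSym λ R → Vec GTerm (arity R)

_≟ᶠ_ : DecidableEquality GFact
_≟ᶠ_ = ×.≡-dec _≟ʳ_ (Vec.≡-dec _≟ᵍ_)

data ChaseTerm : Set
data Derivation : Set
data Trigger : Set

-- A trigger i ts ds fires the i-th TGD with its body variables, listed by bodyVars, bound to ts,
-- the body atoms being derived by ds; null tr z is the null that tr invents for the variable z.
data ChaseTerm where
  const : Const → ChaseTerm
  null  : Trigger → Var → ChaseTerm

data Derivation where
  dbFact : ℕ → Derivation
  fire   : Trigger → ℕ → Derivation

data Trigger where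
  trigger : ℕ → List ChaseTerm → List Derivation → Trigger

termToRose : ChaseTerm → Rose
termsToRose : List ChaseTerm → List Rose
derivToRose : Derivation → Rose
derivsToRose : List Derivation → List Rose
triggerToRose : Trigger → Rose
termToRose (const c)    = node 0 (leaf c ∷ [])
termToRose (null tr z)  = node 1 (triggerToRose tr ∷ leaf z ∷ [])
termsToRose []          = []
termsToRose (t ∷ ts)    = termToRose t ∷ termsToRose ts
derivToRose (dbFact k)  = node 0 (leaf k ∷ [])
derivToRose (fire tr j) = node 1 (triggerToRose tr ∷ leaf j ∷ [])
derivsToRose []         = []
derivsToRose (d ∷ ds)   = derivToRose d ∷ derivsToRose ds
triggerToRose (trigger i ts ds) = node i (node 0 (termsToRose ts) ∷ node 0 (derivsToRose ds) ∷ [])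

roseToTerm : Rose → Maybe ChaseTerm
roseToTerms : List Rose → Maybe (List ChaseTerm)
roseToDeriv : Rose → Maybe Derivation
roseToDerivs : List Rose → Maybe (List Derivation)
roseToTrigger : Rose → Maybe Trigger
roseToTerm (node 0 (node c [] ∷ []))     = just (const c)
roseToTerm (node 1 (r ∷ node z [] ∷ [])) = Maybe.map (λ tr → null tr z) (roseToTrigger r)
roseToTerm _                             = nothing
roseToTerms []       = just []
roseToTerms (r ∷ xs) = Maybe.zipWith _∷_ (roseToTerm r) (roseToTerms xs)
roseToDeriv (node 0 (node k [] ∷ []))     = just (dbFact k)
roseToDeriv (node 1 (r ∷ node j [] ∷ [])) = Maybe.map (λ tr → fire tr j) (roseToTrigger r)
roseToDeriv _                             = nothing
roseToDerivs []       = just []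
roseToDerivs (r ∷ xs) = Maybe.zipWith _∷_ (roseToDeriv r) (roseToDerivs xs)
roseToTrigger (node i (node _ xs ∷ node _ ys ∷ [])) = Maybe.zipWith (trigger i) (roseToTerms xs) (roseToDerivs ys)
roseToTrigger _ = nothing

roseToTerm-termToRose : ∀ t → roseToTerm (termToRose t) ≡ just t
roseToTerms-termsToRose : ∀ ts → roseToTerms (termsToRose ts) ≡ just ts
roseToDeriv-derivToRose : ∀ d → roseToDeriv (derivToRose d) ≡ just d
roseToDerivs-derivsToRose : ∀ ds → roseToDerivs (derivsToRose ds) ≡ just ds
roseToTrigger-triggerToRose : ∀ tr → roseToTrigger (triggerToRose tr) ≡ just tr
roseToTerm-termToRose (const c) = refl
roseToTerm-termToRose (null tr z) rewrite roseToTrigger-triggerToRose tr = refl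
roseToTerms-termsToRose [] = refl
roseToTerms-termsToRose (t ∷ ts)
  rewrite roseToTerm-termToRose t | roseToTerms-termsToRose ts = refl
roseToDeriv-derivToRose (dbFact k) = refl
roseToDeriv-derivToRose (fire tr j) rewrite roseToTrigger-triggerToRose tr = refl
roseToDerivs-derivsToRose [] = refl
roseToDerivs-derivsToRose (d ∷ ds)
  rewrite roseToDeriv-derivToRose d | roseToDerivs-derivsToRose ds = refl
roseToTrigger-triggerToRose (trigger i ts ds)
  rewrite roseToTerms-termsToRose ts | roseToDerivs-derivsToRose ds = refl

code : ChaseTerm → ℕ
code t = encodeRose (termToRose t)

decodeTerm : ℕ → Maybe ChaseTerm
decodeTerm n = decodeRose n >>= roseToTerm

decodeTerm-code : ∀ t → decodeTerm (code t) ≡ just t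
decodeTerm-code t rewrite decodeRose-encodeRose (termToRose t) = roseToTerm-termToRose t

record UniversalModel (D : Database) (Σ' : List TGD) : Set₁ where
  field
    model     : Instance
    contains  : Contains model D
    satisfies : SatTGDs model Σ'
    universal : ∀ I → Contains I D → SatTGDs I Σ' →
                Σ (ℕ → GTerm) λ f → ∀ R v → model R v → I R (map (substNulls f) v)

toGTerm : ChaseTerm → GTerm
toGTerm (const c)   = gcst c
toGTerm (null tr z) = gnull (code (null tr z))

reify : GTerm → ChaseTerm
reify (gcst c)  = const c
reify (gnull n) = Maybe.fromMaybe (const 0) (decodeTerm n)

Reifiable : GTerm → Set
Reifiable g = toGTerm (reify g) ≡ g

toGTerm-reifiable : ∀ t → Reifiable (toGTerm t)
toGTerm-reifiable (const c)   = refl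
toGTerm-reifiable (null tr z) rewrite decodeTerm-code (null tr z) = refl

∈-map-gcst⇒reifiable : ∀ {n} (w : Vec Const n) {g} → g ∈ᵥ map gcst w → Reifiable g
∈-map-gcst⇒reifiable (c ∷ w) (here refl) = refl
∈-map-gcst⇒reifiable (c ∷ w) (there p)   = ∈-map-gcst⇒reifiable w p

∈-map-evalT⇒reifiable : ∀ {ν} → (∀ x → Reifiable (ν x)) →
  ∀ {n} (v : Vec Term n) {g} → g ∈ᵥ map (evalT ν) v → Reifiable g
∈-map-evalT⇒reifiable ν-reifiable (cst c ∷ v) (here refl) = refl
∈-map-evalT⇒reifiable ν-reifiable (var x ∷ v) (here refl) = ν-reifiable x
∈-map-evalT⇒reifiable ν-reifiable (t ∷ v)     (there p)   = ∈-map-evalT⇒reifiable ν-reifiable v p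

module Chase (D : Database) (Σ' : List TGD) where

  bind : TGD → List ChaseTerm → Assignment
  bind τ ts = bodyVars τ ↦ List.map toGTerm ts

  extend : TGD → Trigger → Assignment
  extend τ tr@(trigger _ ts _) x with x ∈? bodyVars τ
  ... | yes _ = bind τ ts x
  ... | no  _ = toGTerm (null tr x)

  extend-∈ : ∀ τ i ts ds {x} → x ∈ bodyVars τ → extend τ (trigger i ts ds) x ≡ bind τ ts x
  extend-∈ τ i ts ds {x} x∈ with x ∈? bodyVars τ
  ... | yes _  = refl
  ... | no x∉  = ⊥-elim (x∉ x∈)

  extend-∉ : ∀ τ tr {x} → x ∉ bodyVars τ → extend τ tr x ≡ toGTerm (null tr x)
  extend-∉ τ (trigger i ts ds) {x} x∉ with x ∈? bodyVars τ
  ... | yes x∈ = ⊥-elim (x∉ x∈)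
  ... | no _   = refl

  extend-reifiable : ∀ τ tr x → Reifiable (extend τ tr x)
  extend-reifiable τ (trigger i ts ds) x with x ∈? bodyVars τ
  ... | yes _ = ↦-All Reifiable refl (bodyVars τ) (map⁺ (All.universal toGTerm-reifiable ts)) x
  ... | no  _ = toGTerm-reifiable (null (trigger i ts ds) x)

  data Derives : Derivation → (R : RelSym) → Vec GTerm (arity R) → Set where
    fromDb : ∀ {k a} → D ! k ≡ just a → Derives (dbFact k) (rel a) (map gcst (args a))
    fired  : ∀ {i τ ts ds j a} → Σ' ! i ≡ just τ →
             Pointwise (λ d b → Derives d (rel b) (map (evalT (bind τ ts)) (args b))) ds (body τ) →
             head τ ! j ≡ just a →
             Derives (fire (trigger i ts ds) j) (rel a) (map (evalT (extend τ (trigger i ts ds))) (args a))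

  DerivesBody : List Derivation → List (Atom Term) → Assignment → Set
  DerivesBody ds as ν = Pointwise (λ d b → Derives d (rel b) (map (evalT ν) (args b))) ds as

  chaseModel : Instance
  chaseModel R v = Σ Derivation λ d → Derives d R v

  derives-reifiable : ∀ {d R v} → Derives d R v → ∀ {g} → g ∈ᵥ v → Reifiable g
  derives-reifiable (fromDb {a = a} _) = ∈-map-gcst⇒reifiable (args a)
  derives-reifiable (fired {i} {τ} {ts} {ds} {a = a} _ _ _) =
    ∈-map-evalT⇒reifiable (extend-reifiable τ (trigger i ts ds)) (args a)

  occurs-reifiable : ∀ {ν} as → All (HoldsAtom chaseModel ν) as → ∀ {x} → OccursIn x as → Reifiable (ν x)
  occurs-reifiable {ν} (a ∷ as) ((_ , d) ∷ _) (here p)  = derives-reifiable d (∈-map⁺ (evalT ν) p)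
  occurs-reifiable     (a ∷ as) (_ ∷ holds)   (there p) = occurs-reifiable as holds p

  derivationsOf : ∀ {σ ν} as → (∀ x → OccursIn x as → σ x ≡ ν x) → All (HoldsAtom chaseModel ν) as →
    Σ (List Derivation) λ ds → DerivesBody ds as σ
  derivationsOf []       σ≗ν []             = [] , []
  derivationsOf (a ∷ as) σ≗ν ((d , d⊢) ∷ holds) =
    let (ds , ds⊢) = derivationsOf as (λ x p → σ≗ν x (there p)) holds
    in d ∷ ds , subst (Derives d (rel a)) (map-evalT-cong (args a) (λ z p → sym (σ≗ν z (here p)))) d⊢ ∷ ds⊢

  chaseModel-sat : ∀ {i τ} → Σ' ! i ≡ just τ → SatTGD chaseModel τ
  chaseModel-sat {i} {τ} τ∈Σ ν body-holds = extend τ tr , extend≗ν , head-holds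
    where
    ts : List ChaseTerm
    ts = List.map (reify ∘ ν) (bodyVars τ)
    bind≗ν : ∀ x → OccursIn x (body τ) → bind τ ts x ≡ ν x
    bind≗ν x occ = begin
      (bodyVars τ ↦ List.map toGTerm ts) x
        ≡⟨ cong (λ ws → (bodyVars τ ↦ ws) x) (sym (map-∘ (bodyVars τ))) ⟩
      (bodyVars τ ↦ List.map (toGTerm ∘ reify ∘ ν) (bodyVars τ)) x
        ≡⟨ ↦-map-self (toGTerm ∘ reify ∘ ν) (bodyVars τ) (occurs⇒∈varsOfAtoms (body τ) occ) ⟩
      toGTerm (reify (ν x))
        ≡⟨ occurs-reifiable (body τ) body-holds occ ⟩
      ν x ∎
      where open ≡-Reasoning
    body-derived : Σ (List Derivation) λ ds → DerivesBody ds (body τ) (bind τ ts)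
    body-derived = derivationsOf (body τ) bind≗ν body-holds
    tr : Trigger
    tr = trigger i ts (proj₁ body-derived)
    extend≗ν : ∀ x → OccursIn x (body τ) → extend τ tr x ≡ ν x
    extend≗ν x occ = trans (extend-∈ τ i ts _ (occurs⇒∈varsOfAtoms (body τ) occ)) (bind≗ν x occ)
    head-holds : All (HoldsAtom chaseModel (extend τ tr)) (head τ)
    head-holds = All.map (λ (j , j↦a) → fire tr j , fired τ∈Σ (proj₂ body-derived) j↦a) (!-complete (head τ))

  chaseModel-contains : Contains chaseModel D
  chaseModel-contains = All.map (λ (k , k↦a) → dbFact k , fromDb k↦a) (!-complete D)

  chaseModel-satisfies : SatTGDs chaseModel Σ'
  chaseModel-satisfies = All.map (λ (i , i↦τ) → chaseModel-sat i↦τ) (!-complete Σ')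

  -- The homomorphism into a model I is computed by replaying provenance in I; since it must be
  -- total, each replayed body fact is checked against the TGD instead of being assumed.
  module Replay (I : Instance) (I⊇D : Contains I D) (I⊨Σ : SatTGDs I Σ') where

    IFact : Set
    IFact = Σ GFact λ f → I (proj₁ f) (proj₂ f)

    matchFact : ∀ a ν (f : GFact) → I (proj₁ f) (proj₂ f) →
      Dec (f ≡ (rel a , map (evalT ν) (args a))) → Maybe (HoldsAtom I ν a)
    matchFact a ν f p (yes refl) = just p
    matchFact a ν f p (no _)     = nothing

    matchAtom : ∀ a ν → Maybe IFact → Maybe (HoldsAtom I ν a)
    matchAtom a ν nothing        = nothing
    matchAtom a ν (just (f , p)) = matchFact a ν f p (f ≟ᶠ (rel a , map (evalT ν) (args a)))

    matchBody : ∀ as ν → List (Maybe IFact) → Maybe (All (HoldsAtom I ν) as)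
    matchBody []       ν []       = just []
    matchBody (a ∷ as) ν (f ∷ fs) = Maybe.zipWith _∷_ (matchAtom a ν f) (matchBody as ν fs)
    matchBody _        _ _        = nothing

    matchAtom-just : ∀ a ν {v} (e : v ≡ map (evalT ν) (args a)) (p : I (rel a) v) →
      matchAtom a ν (just ((rel a , v) , p)) ≡ just (subst (I (rel a)) e p)
    matchAtom-just a ν refl p rewrite ≡-≟-identity _≟ᶠ_ {rel a , map (evalT ν) (args a)} refl = refl

    just-subst : ∀ {R} {v w : Vec GTerm (arity R)} (e : v ≡ w) (p : I R v) →
      _≡_ {A = Maybe IFact} (just ((R , v) , p)) (just ((R , w) , subst (I R) e p))
    just-subst refl p = refl

    Firing : Set
    Firing = Σ TGD λ τ → Σ Assignment λ ν′ → All (HoldsAtom I ν′) (head τ)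

    fireIn : ∀ τ → SatTGD I τ → (ν : Assignment) → Maybe (All (HoldsAtom I ν) (body τ)) → Maybe Firing
    fireIn τ sat ν (just b) = let (ν′ , _ , h) = sat ν b in just (τ , ν′ , h)
    fireIn τ sat ν nothing  = nothing

    replay : Maybe (Σ TGD (SatTGD I)) → List GTerm → List (Maybe IFact) → Maybe Firing
    replay (just (τ , sat)) ws fs = fireIn τ sat (bodyVars τ ↦ ws) (matchBody (body τ) (bodyVars τ ↦ ws) fs)
    replay nothing          ws fs = nothing

    nullValue : Maybe Firing → Var → GTerm
    nullValue (just (_ , ν′ , _)) z = ν′ z
    nullValue nothing             z = gcst 0

    headFact : Maybe Firing → ℕ → Maybe IFact
    headFact (just (_ , ν′ , h)) j = Maybe.map (λ (a , p) → (rel a , map (evalT ν′) (args a)) , p) (lookupAll h j)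
    headFact nothing             j = nothing

    termImage : ChaseTerm → GTerm
    termsImage : List ChaseTerm → List GTerm
    derivImage : Derivation → Maybe IFact
    derivsImage : List Derivation → List (Maybe IFact)
    triggerImage : Trigger → Maybe Firing
    termImage (const c)            = gcst c
    termImage (null tr z)          = nullValue (triggerImage tr) z
    termsImage []                  = []
    termsImage (t ∷ ts)            = termImage t ∷ termsImage ts
    derivImage (dbFact k)          = Maybe.map (λ (a , p) → (rel a , map gcst (args a)) , p) (lookupAll I⊇D k)
    derivImage (fire tr j)         = headFact (triggerImage tr) j
    derivsImage []                 = []
    derivsImage (d ∷ ds)           = derivImage d ∷ derivsImage ds
    triggerImage (trigger i ts ds) = replay (lookupAll I⊨Σ i) (termsImage ts) (derivsImage ds)

    nullImage : ℕ → GTerm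
    nullImage n = maybe′ termImage (gcst 0) (decodeTerm n)

    image : GTerm → GTerm
    image = substNulls nullImage

    image-toGTerm : ∀ t → image (toGTerm t) ≡ termImage t
    image-toGTerm (const c)   = refl
    image-toGTerm (null tr z) = cong (maybe′ termImage (gcst 0)) (decodeTerm-code (null tr z))

    termsImage-map : ∀ ts → termsImage ts ≡ List.map image (List.map toGTerm ts)
    termsImage-map []       = refl
    termsImage-map (t ∷ ts) = cong₂ _∷_ (sym (image-toGTerm t)) (termsImage-map ts)

    replayed : TGD → List ChaseTerm → Assignment
    replayed τ ts = bodyVars τ ↦ termsImage ts

    replayed-bind : ∀ τ ts x → replayed τ ts x ≡ image (bind τ ts x)
    replayed-bind τ ts x = trans (cong (λ ws → (bodyVars τ ↦ ws) x) (termsImage-map ts))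
                                 (↦-map image refl (bodyVars τ) (List.map toGTerm ts) x)

    ReplaysTo : Trigger → TGD → List ChaseTerm → Set
    ReplaysTo tr τ ts = Σ Assignment λ ν′ → Σ (All (HoldsAtom I ν′) (head τ)) λ h →
      triggerImage tr ≡ just (τ , ν′ , h) × (∀ x → OccursIn x (body τ) → ν′ x ≡ image (bind τ ts x))

    extend-image : ∀ τ i ts ds → ((ν′ , h , _ , _) : ReplaysTo (trigger i ts ds) τ ts) →
      ∀ x → image (extend τ (trigger i ts ds) x) ≡ ν′ x
    extend-image τ i ts ds (ν′ , _ , tr↦ , ν′≗) x = by-cases (x ∈? bodyVars τ)
      where
      open ≡-Reasoning
      tr = trigger i ts ds
      by-cases : Dec (x ∈ bodyVars τ) → image (extend τ tr x) ≡ ν′ x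
      by-cases (yes x∈) = begin
        image (extend τ tr x)         ≡⟨ cong image (extend-∈ τ i ts ds x∈) ⟩
        image (bind τ ts x)           ≡⟨ sym (ν′≗ x (∈varsOfAtoms⇒occurs (body τ) x∈)) ⟩
        ν′ x                          ∎
      by-cases (no x∉) = begin
        image (extend τ tr x)         ≡⟨ cong image (extend-∉ τ tr x∉) ⟩
        image (toGTerm (null tr x))   ≡⟨ image-toGTerm (null tr x) ⟩
        nullValue (triggerImage tr) x ≡⟨ cong (λ m → nullValue m x) tr↦ ⟩
        ν′ x                          ∎

    derives-sound : ∀ {d R v} → Derives d R v →
      Σ (I R (map image v)) λ p → derivImage d ≡ just ((R , map image v) , p)
    body-sound : ∀ {ds as ν} → DerivesBody ds as ν → ∀ ν′ → (∀ x → ν′ x ≡ image (ν x)) →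
      Σ (All (HoldsAtom I ν′) as) λ b → matchBody as ν′ (derivsImage ds) ≡ just b
    trigger-sound : ∀ {i τ ts ds} → Σ' ! i ≡ just τ → DerivesBody ds (body τ) (bind τ ts) →
      ReplaysTo (trigger i ts ds) τ ts

    derives-sound (fromDb {k} {a} k↦a) =
      let (p , e) = lookupAll-! I⊇D k k↦a
          e′ = sym (map-substNulls-gcst nullImage (args a))
      in subst (I (rel a)) e′ p , trans (cong (Maybe.map _) e) (just-subst e′ p)
    derives-sound (fired {i} {τ} {ts} {ds} {j} {a} τ∈Σ body⊢ j↦a) =
      let r@(ν′ , h , tr↦ , _) = trigger-sound τ∈Σ body⊢
          (p , e) = lookupAll-! h j j↦a
          ν = extend τ (trigger i ts ds)
          e′ = sym (trans (map-substNulls-evalT (args a) nullImage ν)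
                          (map-evalT-cong (args a) (λ z _ → extend-image τ i ts ds r z)))
      in subst (I (rel a)) e′ p ,
         trans (cong (λ m → headFact m j) tr↦) (trans (cong (Maybe.map _) e) (just-subst e′ p))

    body-sound [] ν′ ν′≗ = [] , refl
    body-sound {d ∷ ds} {a ∷ as} {ν} (d⊢ ∷ ds⊢) ν′ ν′≗ =
      let (p , d↦) = derives-sound d⊢
          (b , ds↦) = body-sound ds⊢ ν′ ν′≗
          e = trans (map-substNulls-evalT (args a) nullImage ν) (map-evalT-cong (args a) (λ z _ → sym (ν′≗ z)))
      in subst (I (rel a)) e p ∷ b ,
         cong₂ (Maybe.zipWith _∷_) (trans (cong (matchAtom a ν′) d↦) (matchAtom-just a ν′ e p)) ds↦

    trigger-sound {i} {τ} {ts} {ds} τ∈Σ body⊢ =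
      let (sat , i↦) = lookupAll-! I⊨Σ i τ∈Σ
          ν = replayed τ ts
          (b , match↦) = body-sound body⊢ ν (replayed-bind τ ts)
          (ν′ , ν′≗ν , h) = sat ν b
      in ν′ , h ,
         trans (cong (λ m → replay m (termsImage ts) (derivsImage ds)) i↦) (cong (fireIn τ sat ν) match↦) ,
         λ x occ → trans (ν′≗ν x occ) (replayed-bind τ ts x)

chase : ∀ D Σ' → UniversalModel D Σ'
chase D Σ' = record
  { model     = chaseModel
  ; contains  = chaseModel-contains
  ; satisfies = chaseModel-satisfies
  ; universal = λ I I⊇D I⊨Σ → let open Replay I I⊇D I⊨Σ in
      nullImage , λ R v (_ , d⊢) → proj₁ (derives-sound d⊢)
  }
  where open Chase D Σ'

-- From UCQs to CQs

entailed-UCQ-follows-from-entailed-CQ : ∀ {Σ' 𝒟 𝒬 D q} → Sem UCQ Σ' 𝒟 𝒬 D q →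
  Σ PFormula λ q′ → Sem CQ Σ' 𝒟 𝒬 D q′ × (∀ I ν → ⟦ q′ ⟧ I ν → ⟦ q ⟧ I ν)
entailed-UCQ-follows-from-entailed-CQ {Σ'} {𝒟} {𝒬} {D} {q} (D∈𝒟 , closed , q∈𝒬 , D,Σ⊨q) =
  canonicalCQ b bs , (D∈𝒟 , canonicalCQ-CQ b bs , canonicalCQ-usesOnly 𝒬 b bs inSchema , entailed) , implies
  where
  open UniversalModel (chase D Σ')
  ν₀ : Assignment
  ν₀ _ = gcst 0
  open Witness (witness-of-⟦⟧ 𝒬 model q ν₀ q∈𝒬 (D,Σ⊨q model contains satisfies ν₀))
    renaming (first to b; rest to bs)
  entailed : Entails D Σ' (canonicalCQ b bs)
  entailed I I⊇D I⊨Σ ν =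
    let (f , f-hom) = universal I I⊇D I⊨Σ
    in canonicalCQ-intro f b bs ν (All.map (λ {c} → f-hom (rel c) (args c)) holds)
  implies : ∀ I ν → ⟦ canonicalCQ b bs ⟧ I ν → ⟦ q ⟧ I ν
  implies I ν p =
    let (μ , b∷bs↦I) = canonicalCQ-elim b bs ν p
    in ⟦⟧-closed q closed _ ν (sufficient I μ b∷bs↦I)

Sem-CQ-transfer : ∀ {Σ₁ Σ₂ 𝒟 𝒬 D q} →
  (Sem UCQ Σ₁ 𝒟 𝒬 D q → Sem UCQ Σ₂ 𝒟 𝒬 D q) → Sem CQ Σ₁ 𝒟 𝒬 D q → Sem CQ Σ₂ 𝒟 𝒬 D q
Sem-CQ-transfer ucq (D∈𝒟 , (closed , shape) , q∈𝒬 , D,Σ₁⊨q) =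
  let (D∈𝒟′ , closed′ , q∈𝒬′ , D,Σ₂⊨q) = ucq (D∈𝒟 , closed , q∈𝒬 , D,Σ₁⊨q)
  in D∈𝒟′ , (closed′ , shape) , q∈𝒬′ , D,Σ₂⊨q

Sem-UCQ-transfer : ∀ {Σ₁ Σ₂ 𝒟 𝒬} → SemEq CQ Σ₁ Σ₂ 𝒟 𝒬 →
  ∀ {D q} → Sem UCQ Σ₁ 𝒟 𝒬 D q → Sem UCQ Σ₂ 𝒟 𝒬 D q
Sem-UCQ-transfer eq s@(D∈𝒟 , closed , q∈𝒬 , _) =
  let (q′ , s′ , q′⇒q) = entailed-UCQ-follows-from-entailed-CQ s
      (_ , _ , _ , D,Σ₂⊨q′) = Equivalence.to (eq _ q′) s′
  in D∈𝒟 , closed , q∈𝒬 , λ I I⊇D I⊨Σ ν → q′⇒q I ν (D,Σ₂⊨q′ I I⊇D I⊨Σ ν)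

SemEq-sym : ∀ {C Σ₁ Σ₂ 𝒟 𝒬} → SemEq C Σ₁ Σ₂ 𝒟 𝒬 → SemEq C Σ₂ Σ₁ 𝒟 𝒬
SemEq-sym eq D q = ⇔-sym (eq D q)

corollary3 : (𝒟 𝒬 : Schema) → Disjoint 𝒟 𝒬 → (Σ₁ Σ₂ : List TGD) →
    SemEq UCQ Σ₁ Σ₂ 𝒟 𝒬 ⇔ SemEq CQ Σ₁ Σ₂ 𝒟 𝒬
corollary3 𝒟 𝒬 _ Σ₁ Σ₂ = mk⇔
  (λ eq D q → mk⇔ (Sem-CQ-transfer (Equivalence.to (eq D q))) (Sem-CQ-transfer (Equivalence.from (eq D q))))
  (λ eq D q → mk⇔ (Sem-UCQ-transfer eq) (Sem-UCQ-transfer (SemEq-sym eq)))
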